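{- Let $D$ be a minimal counterexample to the conjecture described in the context, $C$ its Hamilton cycle, and $x$ a vertex of $D$ none of whose incident edges is green, such that the edge from $x^-$ to $x$ is red (i.e. $x^-\in R^-(x)$). Then for every pair of vertices $m\in B^+_b(x)$ and $n\in R^-_r(x)$ with $m\neq n^+$, the path $mCn$ contains a subpath $pCt$ with $p\in R^+_r(x)$ and $t\in B^-_b(x)$.
   Context: A 3-coloured tournament is a finite tournament each of whose edges is coloured red, blue or green. A triple of vertices spans a $T_3$ if the three edges between them form a directed cycle with three distinct colours. For distinct vertices $u,v$, $u$ monochromatically dominates $v$ in colour $c$ if there is a directed path from $u$ to $v$ all of whose edges have colour $c$. The conjecture: every 3-coloured tournament has a triple spanning a $T_3$ or a vertex monochromatically dominating every other vertex. A minimal counterexample is a 3-coloured tournament $D$ with no $T_3$ and no vertex dominating all others, such that every proper nonempty subtournament has a $T_3$ or a vertex monochromatically dominating all its other vertices within it. Such $D$ has a unique directed Hamilton cycle $C$ such that each vertex monochromatically dominates every vertex except its predecessor on $C$; $v^+$, $v^-$ denote the successor and predecessor of $v$ on $C$, and $uCv$ the subpath of $C$ from $u$ to $v$. Notation: $R^+(x)$ (resp. $R^-(x)$) is the set of vertices to which $x$ sends a red edge (resp. from which $x$ receives a red edge); $B^+(x)$, $B^-(x)$ are defined analogously for blue. For $i\in\{r,b\}$ (red, blue): $R^-_i(x)=\{v\in R^-(x): x \text{ dominates } v \text{ monochromatically in colour } i\}$, $R^+_i(x)=\{v\in R^+(x): v \text{ dominates } x \text{ monochromatically in colour } i\}$,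 and $B^-_i(x)$, $B^+_i(x)$ are defined analogously with $B^\pm(x)$ in place of $R^\pm(x)$. -}

module Defs where

open import Data.Nat using (ℕ; zero; suc; _≤_; _<_)
open import Data.Fin using (Fin)
open import Data.Bool using (Bool; true; false)
open import Data.Product using (Σ; ∃; _×_; _,_)
open import Data.Sum using (_⊎_)
open import Function using (_∘_)
open import Relation.Nullary using (¬_)
open import Relation.Binary.PropositionalEquality using (_≡_; _≢_)

data Colour : Set where
  red blue green : Colour

-- A 3-coloured tournament on the vertex set Fin n.
-- arc u v ≡ true  means the edge between u and v is directed u → v;
-- col u v is the colour of that edge (only meaningful when arc u v ≡ true).
record Tournament3 (n : ℕ) : Set where
  field
    arc    : Fin n → Fin n → Bool
    col    : Fin n → Fin n → Colour
    irrefl : ∀ v → arc v v ≡ false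
    total  : ∀ u v → u ≢ v → (arc u v ≡ true) ⊎ (arc v u ≡ true)
    asym   : ∀ u v → arc u v ≡ true → arc v u ≡ false

module _ {n : ℕ} (D : Tournament3 n) where
  open Tournament3 D

  -- vertex subsets (subtournaments are induced on them)
  Subset : Set
  Subset = Fin n → Bool

  _∈_ : Fin n → Subset → Set
  v ∈ S = S v ≡ true

  full : Subset
  full _ = true

  data MonoPath (S : Subset) (c : Colour) : Fin n → Fin n → Set where
    edge : ∀ {u v} → u ∈ S → v ∈ S → arc u v ≡ true → col u v ≡ c →
           MonoPath S c u v
    step : ∀ {u w v} → u ∈ S → arc u w ≡ true → col u w ≡ c →
           MonoPath S c w v → MonoPath S c u v

  DomIn : Subset → Colour → Fin n → Fin n → Set
  DomIn S c u v = (u ≢ v) × MonoPath S c u v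

  DomsIn : Subset → Fin n → Fin n → Set
  DomsIn S u v = ∃ λ c → DomIn S c u v

  Dom : Colour → Fin n → Fin n → Set
  Dom = DomIn full

  HasT3 : Subset → Set
  HasT3 S = Σ (Fin n) λ a → Σ (Fin n) λ b → Σ (Fin n) λ c →
    a ∈ S × b ∈ S × c ∈ S ×
    arc a b ≡ true × arc b c ≡ true × arc c a ≡ true ×
    col a b ≢ col b c × col b c ≢ col c a × col a b ≢ col c a

  HasDominator : Subset → Set
  HasDominator S = Σ (Fin n) λ v → v ∈ S ×
    (∀ w → w ∈ S → w ≢ v → DomsIn S v w)

  Good : Subset → Set
  Good S = HasT3 S ⊎ HasDominator S

  MinimalCounterexample : Set
  MinimalCounterexample =
    ¬ Good full ×
    (∀ (S : Subset) → (∃ λ v → v ∈ S) → (∃ λ v → S v ≡ false) → Good S)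

  iterate : (Fin n → Fin n) → ℕ → Fin n → Fin n
  iterate f zero    v = v
  iterate f (suc k) v = f (iterate f k v)

  record HamiltonCycle : Set where
    field
      next     : Fin n → Fin n
      nextArc  : ∀ v → arc v (next v) ≡ true
      oneOrbit : ∀ u v → ∃ λ k → iterate next k u ≡ v

  IsDominationCycle : HamiltonCycle → Set
  IsDominationCycle C = ∀ u v → u ≢ v → next v ≢ u → DomsIn full u v
    where open HamiltonCycle C

  R⁺ R⁻ B⁺ B⁻ : Fin n → Fin n → Set
  R⁺ x v = arc x v ≡ true × col x v ≡ red
  R⁻ x v = arc v x ≡ true × col v x ≡ red
  B⁺ x v = arc x v ≡ true × col x v ≡ blue
  B⁻ x v = arc v x ≡ true × col v x ≡ blue

  R⁻[_] R⁺[_] B⁻[_] B⁺[_] : Colour → Fin n → Fin n → Set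
  R⁻[ i ] x v = R⁻ x v × Dom i x v
  R⁺[ i ] x v = R⁺ x v × Dom i v x
  B⁻[ i ] x v = B⁻ x v × Dom i x v
  B⁺[ i ] x v = B⁺ x v × Dom i v x

  NoGreenAt : Fin n → Set
  NoGreenAt x = ∀ v → (arc x v ≡ true → col x v ≢ green) ×
                      (arc v x ≡ true → col v x ≢ green)

module Submission where

-- Away from x and its predecessor, x dominates every vertex in exactly one of red and
-- blue, and every vertex but x⁺ dominates x in exactly one of them; a vertex and its successor
-- never see x in the same colour, since domination of a predecessor is impossible.  Walking
-- along the path from an "anchor" (a vertex receiving a blue edge from x and dominating x in
-- blue, such as m), the first red position gives p; the end of the following red run gives
-- t, unless it is again an anchor, in which case we repeat.  The two non-local steps apply
-- minimality to windows {x} ∪ {v b, …, v i}, proper subtournaments since they miss k⁺.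

open import Defs
open import Data.Nat using (ℕ; zero; suc; pred; _+_; _≤_; _<_; z≤n; s≤s; _≤?_; >-nonZero)
open import Data.Nat.Properties
open import Data.Fin using (Fin; toℕ; fromℕ<) renaming (_≟_ to _≟ᶠ_)
open import Data.Fin.Properties using (pigeonhole; toℕ-fromℕ<; toℕ<n; nonZeroIndex)
  renaming (<⇒≢ to <⇒≢ᶠ)
open import Data.Bool using (true; false)
open import Data.Product using (Σ; _×_; _,_; proj₁; proj₂)
open import Data.Sum using (_⊎_; inj₁; inj₂; [_,_]′)
open import Data.Empty using (⊥; ⊥-elim)
open import Function using (_∘_)
open import Relation.Nullary using (¬_; Dec; yes; no; does)
open import Relation.Nullary.Decidable using (¬?; map′; dec-true; dec-false; _⊎-dec_; _×-dec_)
open import Relation.Binary.PropositionalEquality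

firstUpTo : ∀ {P : ℕ → Set} b → (∀ l → l ≤ b → Dec (P l)) →
            (Σ ℕ λ i → i ≤ b × P i × (∀ l → l < i → ¬ P l)) ⊎ (∀ l → l ≤ b → ¬ P l)
firstUpTo zero P? with P? 0 z≤n
... | yes p0 = inj₁ (0 , z≤n , p0 , λ _ ())
... | no ¬p0 = inj₂ λ { .zero z≤n → ¬p0 }
firstUpTo {P} (suc b) P? with firstUpTo b (λ l l≤b → P? l (m≤n⇒m≤1+n l≤b))
... | inj₁ (i , i≤b , pi , before) = inj₁ (i , m≤n⇒m≤1+n i≤b , pi , before)
... | inj₂ none with P? (suc b) ≤-refl
...   | yes pb = inj₁ (suc b , ≤-refl , pb , λ l l<sb → none l (≤-pred l<sb))
...   | no ¬pb = inj₂ λ l l≤sb → lastOrEarlier l (m≤n⇒m<n∨m≡n l≤sb)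
  where
    lastOrEarlier : ∀ l → l < suc b ⊎ l ≡ suc b → ¬ P l
    lastOrEarlier l (inj₁ l<sb) = none l (≤-pred l<sb)
    lastOrEarlier l (inj₂ refl) = ¬pb

firstIn : ∀ {P : ℕ → Set} {a b} → a ≤ b → (∀ l → a ≤ l → l ≤ b → Dec (P l)) → P b →
          Σ ℕ λ i → a ≤ i × i ≤ b × P i × (∀ l → a ≤ l → l < i → ¬ P l)
firstIn {P} {a} {b} a≤b P? pb with firstUpTo {P = λ l → a ≤ l × P l} b decideFrom
  where
    decideFrom : ∀ l → l ≤ b → Dec (a ≤ l × P l)
    decideFrom l l≤b with a ≤? l
    ... | yes a≤l = map′ (a≤l ,_) proj₂ (P? l a≤l l≤b)
    ... | no a≰l  = no (a≰l ∘ proj₁)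
... | inj₁ (i , i≤b , (a≤i , pi) , before) = i , a≤i , i≤b , pi , λ l a≤l l<i pl → before l l<i (a≤l , pl)
... | inj₂ none = ⊥-elim (none b ≤-refl (a≤b , pb))

data AtOrAfter (b : ℕ) : ℕ → Set where
  at    : AtOrAfter b b
  after : ∀ {l} → b ≤ l → AtOrAfter b (suc l)

atOrAfter : ∀ {b l} → b ≤ l → AtOrAfter b l
atOrAfter {b} {l} b≤l with m≤n⇒m<n∨m≡n b≤l
... | inj₂ refl = at
atOrAfter {b} {suc l} _ | inj₁ b<l = after (≤-pred b<l)

-- Moving forward at least one position consumes one unit of fuel.
shiftFuel : ∀ {n} f {b j} → n ≤ suc f + b → b < j → n ≤ f + j
shiftFuel f {b} n≤ b<j = ≤-trans n≤ (≤-trans (≤-reflexive (sym (+-suc f b))) (+-monoʳ-≤ f b<j))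

module Cycle {N : ℕ} (D : Tournament3 N) (C : HamiltonCycle D) where
  open HamiltonCycle C

  it : ℕ → Fin N → Fin N
  it = iterate D next

  it-add : ∀ a b u → it (a + b) u ≡ it a (it b u)
  it-add zero    b u = refl
  it-add (suc a) b u = cong next (it-add a b u)

  it-suc : ∀ a u → it (suc a) u ≡ it a (next u)
  it-suc a u = trans (cong (λ t → it t u) (+-comm 1 a)) (it-add a 1 u)

  closedOrbit : ∀ p u → it (suc p) u ≡ u → ∀ k → Σ ℕ λ i → i ≤ p × it i u ≡ it k u
  closedOrbit p u back zero = 0 , z≤n , refl
  closedOrbit p u back (suc k) with closedOrbit p u back k
  ... | i , i≤p , same with m≤n⇒m<n∨m≡n i≤p
  ...   | inj₁ i<p  = suc i , i<p , cong next same
  ...   | inj₂ refl = 0 , z≤n , trans (sym back) (cong next same)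

  orbitIndex : ∀ p u → it (suc p) u ≡ u → Fin N → Fin (suc p)
  orbitIndex p u back v = fromℕ< (s≤s (proj₁ (proj₂ (closedOrbit p u back (proj₁ (oneOrbit u v))))))

  atOrbitIndex : ∀ p u back v → it (toℕ (orbitIndex p u back v)) u ≡ v
  atOrbitIndex p u back v = begin
    it (toℕ (orbitIndex p u back v)) u  ≡⟨ cong (λ t → it t u) (toℕ-fromℕ< (s≤s (proj₁ (proj₂ place)))) ⟩
    it (proj₁ place) u                  ≡⟨ proj₂ (proj₂ place) ⟩
    it k u                              ≡⟨ proj₂ (oneOrbit u v) ⟩
    v                                   ∎
    where
      open ≡-Reasoning
      k = proj₁ (oneOrbit u v)
      place = closedOrbit p u back k

  -- Since C passes through all N vertices, no vertex returns to itself in fewer than N steps.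
  noShortCycle : ∀ p u → it (suc p) u ≡ u → N ≤ suc p
  noShortCycle p u back with N ≤? suc p
  ... | yes N≤ = N≤
  ... | no N≰ with pigeonhole (≰⇒> N≰) (orbitIndex p u back)
  ...   | a , b , a<b , same = ⊥-elim (<⇒≢ᶠ a<b (begin
            a                                     ≡⟨ sym (atOrbitIndex p u back a) ⟩
            it (toℕ (orbitIndex p u back a)) u    ≡⟨ cong (λ i → it (toℕ i) u) same ⟩
            it (toℕ (orbitIndex p u back b)) u    ≡⟨ atOrbitIndex p u back b ⟩
            b                                     ∎))
    where open ≡-Reasoning

  period : ∀ u → it N u ≡ u
  period u with pigeonhole (n<1+n N) (λ l → it (toℕ l) u)
  ... | a , b , a<b , same with m≤n⇒∃[o]m+o≡n a<b
  ...   | o , gap = begin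
            it N u                ≡⟨ cong (it N) (sym (proj₂ (oneOrbit z u))) ⟩
            it N (it r z)         ≡⟨ sym (it-add N r z) ⟩
            it (N + r) z          ≡⟨ cong (λ t → it t z) (+-comm N r) ⟩
            it (r + N) z          ≡⟨ it-add r N z ⟩
            it r (it N z)         ≡⟨ cong (it r) zPeriod ⟩
            it r z                ≡⟨ proj₂ (oneOrbit z u) ⟩
            u                     ∎
    where
      open ≡-Reasoning
      z = it (toℕ a) u
      r = proj₁ (oneOrbit z u)
      gap′ : suc o + toℕ a ≡ toℕ b
      gap′ = trans (cong suc (+-comm o (toℕ a))) gap
      zReturns : it (suc o) z ≡ z
      zReturns = begin
        it (suc o) z           ≡⟨ sym (it-add (suc o) (toℕ a) u) ⟩
        it (suc o + toℕ a) u   ≡⟨ cong (λ t → it t u) gap′ ⟩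
        it (toℕ b) u           ≡⟨ sym same ⟩
        z                      ∎
      zPeriod : it N z ≡ z
      zPeriod = subst (λ t → it t z ≡ z)
        (≤-antisym (≤-trans (m≤m+n (suc o) (toℕ a)) (≤-trans (≤-reflexive gap′) (≤-pred (toℕ<n b))))
                   (noShortCycle o z zReturns))
        zReturns

  previous : Fin N → Fin N
  previous v = it (pred N) v

  next-previous : ∀ v → next (previous v) ≡ v
  next-previous v = trans (cong (λ t → it t v) (suc-pred N {{nonZeroIndex v}})) (period v)

  previous-next : ∀ v → previous (next v) ≡ v
  previous-next v = trans (sym (it-suc (pred N) v))
                          (trans (cong (λ t → it t v) (suc-pred N {{nonZeroIndex v}})) (period v))

  next-injective : ∀ {u v} → next u ≡ next v → u ≡ v
  next-injective {u} {v} same = trans (sym (previous-next u)) (trans (cong previous same) (previous-next v))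

  orbitDistinct : ∀ u {a b} → a < b → b < N → it a u ≢ it b u
  orbitDistinct u {a} {b} a<b b<N same with m≤n⇒∃[o]m+o≡n a<b
  ... | o , gap = <⇒≱ (≤-<-trans (≤-trans (m≤m+n (suc o) a) (≤-reflexive gap′)) b<N)
                      (noShortCycle o (it a u) returns)
    where
      gap′ : suc o + a ≡ b
      gap′ = trans (cong suc (+-comm o a)) gap
      returns : it (suc o) (it a u) ≡ it a u
      returns = trans (sym (it-add (suc o) a u)) (trans (cong (λ t → it t u) gap′) (sym same))

witness : ∀ {A : Set} (a? : Dec A) → does a? ≡ true → A
witness (yes a) _ = a

module MinimalCounterexampleFacts {N : ℕ} (D : Tournament3 N) (MC : MinimalCounterexample D)
  (C : HamiltonCycle D) (DC : IsDominationCycle D C) where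
  open Tournament3 D
  open HamiltonCycle C
  open Cycle D C

  arc-irrefl : ∀ {u v} → arc u v ≡ true → u ≢ v
  arc-irrefl {u} uv refl with trans (sym (irrefl u)) uv
  ... | ()

  arc-asym : ∀ {u v} → arc u v ≡ true → arc v u ≡ true → ⊥
  arc-asym {u} {v} uv vu with trans (sym (asym u v uv)) vu
  ... | ()

  edgeDom : ∀ {c u v} → arc u v ≡ true → col u v ≡ c → Dom D c u v
  edgeDom uv c = arc-irrefl uv , edge refl refl uv c

  _++_ : ∀ {c u w v} → MonoPath D (full D) c u w → MonoPath D (full D) c w v → MonoPath D (full D) c u v
  edge u∈ _ uw c ++ q = step u∈ uw c q
  step u∈ uw c p ++ q = step u∈ uw c (p ++ q)

  lift : ∀ {S c u v} → MonoPath D S c u v → MonoPath D (full D) c u v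
  lift (edge _ _ uv c)  = edge refl refl uv c
  lift (step _ uw c p) = step refl uw c (lift p)

  firstEdge : ∀ {S c u v} → MonoPath D S c u v → Σ (Fin N) λ w → S w ≡ true × arc u w ≡ true × col u w ≡ c
  firstEdge (edge _ v∈ uv c)          = _ , v∈ , uv , c
  firstEdge (step _ uw c (edge w∈ _ _ _)) = _ , w∈ , uw , c
  firstEdge (step _ uw c (step w∈ _ _ _)) = _ , w∈ , uw , c

  lastEdge : ∀ {S c u v} → MonoPath D S c u v → Σ (Fin N) λ t → S t ≡ true × arc t v ≡ true × col t v ≡ c
  lastEdge (edge u∈ _ uv c) = _ , u∈ , uv , c
  lastEdge (step _ _ _ p)  = lastEdge p

  -- No vertex dominates its predecessor on C: it would then dominate every vertex of D.
  noBackwardDomination : ∀ {u w} → next u ≡ w → DomsIn D (full D) w u → ⊥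
  noBackwardDomination {u} refl wDomU = proj₁ MC (inj₂ (next u , refl , λ v _ v≢w → dominates v v≢w))
    where
      dominates : ∀ v → v ≢ next u → DomsIn D (full D) (next u) v
      dominates v v≢w with next v ≟ᶠ next u
      ... | yes same rewrite next-injective same = wDomU
      ... | no differ = DC (next u) v (v≢w ∘ sym) differ

  noRelay : ∀ {c y u w} → next u ≡ w → Dom D c w y → Dom D c y u → ⊥
  noRelay {c} {u = u} refl (_ , p) (_ , q) =
    noBackwardDomination refl (c , (λ e → arc-irrefl (nextArc u) (sym e)) , p ++ q)

  module GreenFree (x : Fin N) (NG : NoGreenAt D x) where

    notGreenFrom : ∀ {S c u} → MonoPath D S c x u → c ≢ green
    notGreenFrom p refl with firstEdge p
    ... | w , _ , xw , c = proj₁ (NG w) xw c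

    notGreenTo : ∀ {S c u} → MonoPath D S c u x → c ≢ green
    notGreenTo p refl with lastEdge p
    ... | t , _ , tx , c = proj₂ (NG t) tx c

    xDominates : ∀ u → u ≢ x → next u ≢ x → Dom D red x u ⊎ Dom D blue x u
    xDominates u u≢x nu≢x with DC x u (u≢x ∘ sym) nu≢x
    ... | red   , dom     = inj₁ dom
    ... | blue  , dom     = inj₂ dom
    ... | green , (_ , p) = ⊥-elim (notGreenFrom p refl)

    dominatesX : ∀ u → u ≢ x → next x ≢ u → Dom D red u x ⊎ Dom D blue u x
    dominatesX u u≢x nx≢u with DC u x u≢x nx≢u
    ... | red   , dom     = inj₁ dom
    ... | blue  , dom     = inj₂ dom
    ... | green , (_ , p) = ⊥-elim (notGreenTo p refl)

    -- x dominates no vertex in both red and blue: the successor of that vertex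
    -- dominates x in one of the two colours, which would relay back to the vertex.
    notBothFrom : ∀ u → next u ≢ x → Dom D red x u → Dom D blue x u → ⊥
    notBothFrom u nu≢x r@(x≢u , _) b with dominatesX (next u) nu≢x (x≢u ∘ next-injective)
    ... | inj₁ r′ = noRelay refl r′ r
    ... | inj₂ b′ = noRelay refl b′ b

    -- Dually, no vertex dominates x in both red and blue (look at its predecessor).
    notBothTo : ∀ u → u ≢ x → Dom D red u x → Dom D blue u x → ⊥
    notBothTo u u≢x r b with previous u ≟ᶠ x
    ... | yes p≡x = noBackwardDomination (trans (cong next (sym p≡x)) (next-previous u)) (red , r)
    ... | no p≢x with xDominates (previous u) p≢x (λ e → u≢x (trans (sym (next-previous u)) e))
    ...   | inj₁ r′ = noRelay (next-previous u) r r′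
    ...   | inj₂ b′ = noRelay (next-previous u) b b′

    data EdgeAt (u : Fin N) : Set where
      outRed  : R⁺ D x u → EdgeAt u
      outBlue : B⁺ D x u → EdgeAt u
      inRed   : R⁻ D x u → EdgeAt u
      inBlue  : B⁻ D x u → EdgeAt u

    edgeAt : ∀ u → u ≢ x → EdgeAt u
    edgeAt u u≢x with total x u (u≢x ∘ sym)
    ... | inj₁ xu with col x u in c
    ...   | red   = outRed (xu , c)
    ...   | blue  = outBlue (xu , c)
    ...   | green = ⊥-elim (proj₁ (NG u) xu c)
    edgeAt u u≢x | inj₂ ux with col u x in c
    ...   | red   = inRed (ux , c)
    ...   | blue  = inBlue (ux , c)
    ...   | green = ⊥-elim (proj₂ (NG u) ux c)

    -- The path mCk = v 0, v 1, …, v d with d < N, ending at k = v d ∈ R⁻_r(x), with next k ≠ m.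
    module OnPath (m : Fin N) (d : ℕ) (d<N : d < N)
                  (end∈ : R⁻[_] D red x (it d m)) (unclosed : next (it d m) ≢ m) where

      v : ℕ → Fin N
      v l = it l m

      Red Blue : ℕ → Set
      Red  l = Dom D red x (v l)
      Blue l = Dom D blue x (v l)

      Anchor : ℕ → Set
      Anchor b = B⁺ D x (v b) × (Dom D blue (v b) x ⊎ next x ≡ v b)

      Result : Set
      Result = Σ ℕ λ i → Σ ℕ λ j → i ≤ j × j ≤ d × R⁺[_] D red x (v i) × B⁻[_] D blue x (v j)

      -- k is not the predecessor of x, since x dominates it.
      endNextNotX : next (v d) ≢ x
      endNextNotX e = noBackwardDomination e (red , proj₂ end∈)

      -- x does not dominate the vertex before k in red: k would relay red back to it.
      notRedBeforeEnd : 0 < d → ¬ Red (pred d)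
      notRedBeforeEnd 0<d = noRelay (cong v (suc-pred d {{>-nonZero 0<d}}))
                                    (edgeDom (proj₁ (proj₁ end∈)) (proj₂ (proj₁ end∈)))

      -- An out-neighbour of x on the path comes before k, which is an in-neighbour.
      outNeighbourBeforeEnd : ∀ {l} → l ≤ d → arc x (v l) ≡ true → l < d
      outNeighbourBeforeEnd l≤d xl = ≤∧≢⇒< l≤d λ { refl → arc-asym xl (proj₁ (proj₁ end∈)) }

      avoidsEnd : ∀ l → l ≤ d → v l ≢ next (v d)
      avoidsEnd zero    _   e = unclosed (sym e)
      avoidsEnd (suc l) l<d e = orbitDistinct m l<d d<N (next-injective e)

      Between : ℕ → ℕ → Fin N → Set
      Between b i u = Σ ℕ λ l → b ≤ l × l ≤ i × v l ≡ u

      between? : ∀ b i u → Dec (Between b i u)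
      between? b i u with firstUpTo i (λ l _ → (b ≤? l) ×-dec (v l ≟ᶠ u))
      ... | inj₁ (l , l≤i , (b≤l , e) , _) = yes (l , b≤l , l≤i , e)
      ... | inj₂ none = no λ (l , b≤l , l≤i , e) → none l l≤i (b≤l , e)

      window : ℕ → ℕ → Subset D
      window b i u = does ((u ≟ᶠ x) ⊎-dec between? b i u)

      inWindow : ∀ {b i u} → window b i u ≡ true → u ≡ x ⊎ Between b i u
      inWindow {b} {i} {u} = witness ((u ≟ᶠ x) ⊎-dec between? b i u)

      x∈window : ∀ {b i} → window b i x ≡ true
      x∈window {b} {i} = dec-true ((x ≟ᶠ x) ⊎-dec between? b i x) (inj₁ refl)

      path∈window : ∀ {b i l} → b ≤ l → l ≤ i → window b i (v l) ≡ true
      path∈window {b} {i} {l} b≤l l≤i =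
        dec-true ((v l ≟ᶠ x) ⊎-dec between? b i (v l)) (inj₂ (l , b≤l , l≤i , refl))

      end∉window : ∀ {b i} → i ≤ d → window b i (next (v d)) ≡ false
      end∉window {b} {i} i≤d = dec-false ((next (v d) ≟ᶠ x) ⊎-dec between? b i (next (v d)))
        λ { (inj₁ e) → endNextNotX e
          ; (inj₂ (l , _ , l≤i , e)) → avoidsEnd l (≤-trans l≤i i≤d) e }

      firstStepFromX : ∀ {b i c u} → MonoPath D (window b i) c x u →
                       Σ ℕ λ l → b ≤ l × l ≤ i × arc x (v l) ≡ true × col x (v l) ≡ c
      firstStepFromX {b} {i} p with firstEdge p
      ... | w , w∈ , xw , c with inWindow {b} {i} w∈
      ...   | inj₁ refl                 = ⊥-elim (arc-irrefl xw refl)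
      ...   | inj₂ (l , b≤l , l≤i , refl) = l , b≤l , l≤i , xw , c

      lastStepToX : ∀ {b i c u} → MonoPath D (window b i) c u x →
                    Σ ℕ λ l → b ≤ l × l ≤ i × arc (v l) x ≡ true × col (v l) x ≡ c
      lastStepToX {b} {i} p with lastEdge p
      ... | t , t∈ , tx , c with inWindow {b} {i} t∈
      ...   | inj₁ refl                 = ⊥-elim (arc-irrefl tx refl)
      ...   | inj₂ (l , b≤l , l≤i , refl) = l , b≤l , l≤i , tx , c

      module Segment (a : ℕ) (x∉ : ∀ l → a ≤ l → l ≤ d → v l ≢ x) where

        -- No vertex of the segment precedes x on C: its successor is on the segment or is next k.
        nextNotX : ∀ {l} → a ≤ l → l ≤ d → next (v l) ≢ x
        nextNotX {l} a≤l l≤d with m≤n⇒m<n∨m≡n l≤d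
        ... | inj₁ l<d  = x∉ (suc l) (m≤n⇒m≤1+n a≤l) l<d
        ... | inj₂ refl = endNextNotX

        redOrBlue : ∀ {l} → a ≤ l → l ≤ d → Red l ⊎ Blue l
        redOrBlue {l} a≤l l≤d = xDominates (v l) (x∉ l a≤l l≤d) (nextNotX a≤l l≤d)

        notRedAndBlue : ∀ {l} → a ≤ l → l ≤ d → Red l → Blue l → ⊥
        notRedAndBlue {l} a≤l l≤d = notBothFrom (v l) (nextNotX a≤l l≤d)

        red? : ∀ {l} → a ≤ l → l ≤ d → Dec (Red l)
        red? a≤l l≤d with redOrBlue a≤l l≤d
        ... | inj₁ r = yes r
        ... | inj₂ b = no λ r → notRedAndBlue a≤l l≤d r b

        blueOf : ∀ {l} → a ≤ l → l ≤ d → ¬ Red l → Blue l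
        blueOf a≤l l≤d ¬r with redOrBlue a≤l l≤d
        ... | inj₁ r = ⊥-elim (¬r r)
        ... | inj₂ b = b

        redOf : ∀ {l} → a ≤ l → l ≤ d → ¬ ¬ Red l → Red l
        redOf a≤l l≤d ¬¬r with red? a≤l l≤d
        ... | yes r  = r
        ... | no ¬r  = ⊥-elim (¬¬r ¬r)

        successorDominatesX : ∀ {l} → a ≤ l → suc l ≤ d → Dom D red (v (suc l)) x ⊎ Dom D blue (v (suc l)) x
        successorDominatesX {l} a≤l l<d =
          dominatesX (v (suc l)) (x∉ (suc l) (m≤n⇒m≤1+n a≤l) l<d)
                     (λ e → x∉ l a≤l (<⇒≤ l<d) (sym (next-injective e)))

        afterRed : ∀ {l} → a ≤ l → suc l ≤ d → Red l → Dom D blue (v (suc l)) x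
        afterRed a≤l l<d r with successorDominatesX a≤l l<d
        ... | inj₁ r′ = ⊥-elim (noRelay refl r′ r)
        ... | inj₂ b′ = b′

        afterBlue : ∀ {l} → a ≤ l → suc l ≤ d → Blue l → Dom D red (v (suc l)) x
        afterBlue a≤l l<d b with successorDominatesX a≤l l<d
        ... | inj₁ r′ = r′
        ... | inj₂ b′ = ⊥-elim (noRelay refl b′ b)

        -- In a dominated window only its first path vertex can be the dominating vertex,
        -- as any later v l would dominate its predecessor v (l - 1).
        pathDominator : ∀ {b i l} → a ≤ b → i ≤ d → b ≤ l → l ≤ i →
          (∀ u → window b i u ≡ true → u ≢ v l → DomsIn D (window b i) (v l) u) →
          Σ Colour λ c → MonoPath D (window b i) c (v b) x
        pathDominator {b} {i} a≤b i≤d b≤l l≤i dom with atOrAfter b≤l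
        ... | at with dom x (x∈window {b} {i}) (x∉ b a≤b (≤-trans l≤i i≤d) ∘ sym)
        ...   | c , _ , p = c , p
        pathDominator {b} {i} a≤b i≤d b≤l l≤i dom | after {l} b≤l′
          with dom (v l) (path∈window b≤l′ (≤-trans (n≤1+n l) l≤i)) (arc-irrefl (nextArc (v l)))
        ...   | c , ne , p = ⊥-elim (noBackwardDomination refl (c , ne , lift p))

        -- Minimality applied to the window {x} ∪ {v b, …, v i}, a proper subtournament
        -- since it misses next k: either x or v b dominates it.
        windowDominator : ∀ {b i} → a ≤ b → b ≤ i → i ≤ d →
          (Σ Colour λ c → MonoPath D (window b i) c x (v i)) ⊎ (Σ Colour λ c → MonoPath D (window b i) c (v b) x)
        windowDominator {b} {i} a≤b b≤i i≤d
          with proj₂ MC (window b i) (x , x∈window {b} {i}) (next (v d) , end∉window i≤d)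
        ... | inj₁ (p , q , r , _ , _ , _ , t3) = ⊥-elim (proj₁ MC (inj₁ (p , q , r , refl , refl , refl , t3)))
        ... | inj₂ (w , w∈ , dom) with inWindow {b} {i} w∈
        ...   | inj₁ refl with dom (v i) (path∈window b≤i ≤-refl) (x∉ i (≤-trans a≤b b≤i) i≤d)
        ...     | c , _ , p = inj₁ (c , p)
        windowDominator {b} {i} a≤b b≤i i≤d | inj₂ (w , w∈ , dom) | inj₂ (l , b≤l , l≤i , refl) =
          inj₂ (pathDominator a≤b i≤d b≤l l≤i dom)

        -- An edge v i → x in red is excluded by the window
        -- {x} ∪ {v b, …, v i}: neither x nor v b can dominate it.
        redEntry : ∀ {b i} → a ≤ b → b < i → i ≤ d → Anchor b →
                   (∀ l → b ≤ l → l < i → Blue l) → Red i → R⁺[_] D red x (v i)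
        redEntry {b} {suc i} a≤b b<i i≤d (xb , anchored) blueRun redI =
          entry (edgeAt (v (suc i)) (x∉ (suc i) a≤i i≤d))
          where
            a≤i : a ≤ suc i
            a≤i = ≤-trans a≤b (<⇒≤ b<i)
            dom : Dom D red (v (suc i)) x
            dom = afterBlue (≤-trans a≤b (≤-pred b<i)) i≤d (blueRun i (≤-pred b<i) ≤-refl)
            noneFromX : R⁻ D x (v (suc i)) → ∀ {c} → MonoPath D (window b (suc i)) c x (v (suc i)) → ⊥
            noneFromX _ {green} p = notGreenFrom p refl
            noneFromX _ {blue}  p = notRedAndBlue a≤i i≤d redI (proj₁ redI , lift p)
            noneFromX (ix , _) {red} p with firstStepFromX p
            ... | l , b≤l , l≤i , xl , c with m≤n⇒m<n∨m≡n l≤i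
            ...   | inj₁ l<i  = notRedAndBlue (≤-trans a≤b b≤l) (≤-trans l≤i i≤d)
                                              (edgeDom xl c) (blueRun l b≤l l<i)
            ...   | inj₂ refl = arc-asym xl ix
            noneToX : ∀ {c} → MonoPath D (window b (suc i)) c (v b) x → ⊥
            noneToX {green} p = notGreenTo p refl
            noneToX {red}   p = [ (λ blueDom → notBothTo (v b) vb≢x (vb≢x , lift p) blueDom)
                                , (λ nx≡vb → noBackwardDomination nx≡vb (red , vb≢x , lift p)) ]′ anchored
              where vb≢x = x∉ b a≤b (≤-trans (<⇒≤ b<i) i≤d)
            noneToX {blue}  p with lastStepToX p
            ... | l , b≤l , l≤i , lx , c with atOrAfter b≤l
            ...   | at          = arc-asym (proj₁ xb) lx
            ...   | after {l′} b≤l′ = noRelay refl (edgeDom lx c) (blueRun l′ b≤l′ l≤i)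
            entry : EdgeAt (v (suc i)) → R⁺[_] D red x (v (suc i))
            entry (outRed e)  = e , dom
            entry (outBlue e) = ⊥-elim (notRedAndBlue a≤i i≤d redI (edgeDom (proj₁ e) (proj₂ e)))
            entry (inBlue e)  = ⊥-elim (notBothTo (v (suc i)) (proj₁ dom) dom (edgeDom (proj₁ e) (proj₂ e)))
            entry (inRed e) with windowDominator a≤b (<⇒≤ b<i) i≤d
            ... | inj₁ (_ , p) = ⊥-elim (noneFromX e p)
            ... | inj₂ (_ , p) = ⊥-elim (noneToX p)

        blueExit : ∀ {j} → a ≤ j → suc j ≤ d → Red j → ¬ Red (suc j) →
                   B⁻[_] D blue x (v (suc j)) ⊎ Anchor (suc j)
        blueExit {j} a≤j j<d redJ ¬red = exit (edgeAt (v (suc j)) (x∉ (suc j) (m≤n⇒m≤1+n a≤j) j<d))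
          where
            dom : Dom D blue (v (suc j)) x
            dom = afterRed a≤j j<d redJ
            exit : EdgeAt (v (suc j)) → B⁻[_] D blue x (v (suc j)) ⊎ Anchor (suc j)
            exit (outRed e)  = ⊥-elim (¬red (edgeDom (proj₁ e) (proj₂ e)))
            exit (outBlue e) = inj₂ (e , inj₁ dom)
            exit (inRed e)   = ⊥-elim (notBothTo (v (suc j)) (proj₁ dom) (edgeDom (proj₁ e) (proj₂ e)) dom)
            exit (inBlue e)  = inj₁ (e , blueOf (m≤n⇒m≤1+n a≤j) j<d ¬red)

        -- Claim C. Where a red run starting at the successor of x ends, at j, x sends a blue
        -- edge to v j (by the window {x} ∪ {v b, …, v j}), so j is an anchor.
        blueEntry : ∀ {b j} → a ≤ b → b < j → j ≤ d → next x ≡ v b →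
                    (∀ l → b ≤ l → l < j → Red l) → ¬ Red j → Anchor j
        blueEntry {b} {suc j} a≤b b<j j≤d nx≡vb redRun ¬redJ with windowDominator a≤b (<⇒≤ b<j) j≤d
        ... | inj₂ (c , p) =
          ⊥-elim (noBackwardDomination nx≡vb (c , x∉ b a≤b (≤-trans (<⇒≤ b<j) j≤d) , lift p))
        ... | inj₁ (c , p) = fromX c p
          where
            a≤j : a ≤ suc j
            a≤j = ≤-trans a≤b (<⇒≤ b<j)
            dom : Dom D blue (v (suc j)) x
            dom = afterRed (≤-trans a≤b (≤-pred b<j)) j≤d (redRun j (≤-pred b<j) ≤-refl)
            fromX : ∀ c → MonoPath D (window b (suc j)) c x (v (suc j)) → Anchor (suc j)
            fromX green p = ⊥-elim (notGreenFrom p refl)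
            fromX red   p = ⊥-elim (¬redJ (x∉ (suc j) a≤j j≤d ∘ sym , lift p))
            fromX blue  p with firstStepFromX p
            ... | l , b≤l , l≤j , xl , c with m≤n⇒m<n∨m≡n l≤j
            ...   | inj₁ l<j  = ⊥-elim (notRedAndBlue (≤-trans a≤b b≤l) (≤-trans l≤j j≤d)
                                                      (redRun l b≤l l<j) (edgeDom xl c))
            ...   | inj₂ refl = (xl , c) , inj₁ dom

        -- The first red position after a non-red position b; it exists since v d = k is red.
        firstRedAfter : ∀ {b} → a ≤ b → b ≤ d → ¬ Red b →
                        Σ ℕ λ i → b < i × i ≤ d × Red i × (∀ l → b ≤ l → l < i → Blue l)
        firstRedAfter {b} a≤b b≤d ¬redB
          with firstIn b≤d (λ l b≤l l≤d → red? (≤-trans a≤b b≤l) l≤d) (proj₂ end∈)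
        ... | i , b≤i , i≤d , redI , before =
          i , ≤∧≢⇒< b≤i (λ { refl → ¬redB redI }) , i≤d , redI ,
          λ l b≤l l<i → blueOf (≤-trans a≤b b≤l) (≤-trans (<⇒≤ l<i) i≤d) (before l b≤l l<i)

        -- A red run starting at i < d ends before d, since the vertex before k is not red.
        RedRunEnd : ℕ → Set
        RedRunEnd i = Σ ℕ λ j → i ≤ j × suc j ≤ d × (∀ l → i ≤ l → l ≤ j → Red l) × ¬ Red (suc j)

        redRunEnds : ∀ {i} → a ≤ i → i < d → Red i → RedRunEnd i
        redRunEnds {i} a≤i i<d redI
          with firstIn (pred-mono-≤ i<d)
                       (λ l i≤l l≤d → ¬? (red? (≤-trans a≤i i≤l) (≤-trans l≤d pred[n]≤n)))
                       (notRedBeforeEnd (m<n⇒0<n i<d))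
        ... | j′ , i≤j′ , j′<d , ¬redJ′ , before with atOrAfter i≤j′
        ...   | at = ⊥-elim (¬redJ′ redI)
        ...   | after {j} i≤j =
          j , i≤j , ≤-trans j′<d pred[n]≤n ,
          (λ l i≤l l≤j → redOf (≤-trans a≤i i≤l) (≤-trans (≤-trans (m≤n⇒m≤1+n l≤j) j′<d) pred[n]≤n)
                               (before l i≤l (s≤s l≤j))) ,
          ¬redJ′

        RedStretch : ℕ → Set
        RedStretch b = Σ ℕ λ i → Σ ℕ λ j → b < i × i ≤ j × suc j ≤ d ×
                         R⁺[_] D red x (v i) × Red j × ¬ Red (suc j)

        redStretch : ∀ {b} → a ≤ b → b ≤ d → Anchor b → RedStretch b
        redStretch a≤b b≤d anchor@((xb , cb) , _)
          with firstRedAfter a≤b b≤d (λ r → notRedAndBlue a≤b b≤d r (edgeDom xb cb))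
        ... | i , b<i , i≤d , redI , blueRun with redEntry a≤b b<i i≤d anchor blueRun redI
        ...   | p∈
          with redRunEnds (≤-trans a≤b (<⇒≤ b<i)) (outNeighbourBeforeEnd i≤d (proj₁ (proj₁ p∈))) redI
        ...     | j , i≤j , j<d , redRun , ¬redJ = i , j , b<i , i≤j , j<d , p∈ , redRun j i≤j ≤-refl , ¬redJ

        -- From an anchor b: the red entry p after it, followed by the end t of its red run,
        -- answers the claim unless t is a later anchor, from which we start again; the fuel
        -- bounds the number of restarts, as anchors strictly increase and stay below d.
        fromAnchor : ∀ fuel {b} → d ≤ fuel + b → a ≤ b → b ≤ d → Anchor b → Result
        fromAnchor zero d≤b _ b≤d ((xb , _) , _) = ⊥-elim (<⇒≱ (outNeighbourBeforeEnd b≤d xb) d≤b)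
        fromAnchor (suc fuel) {b} d≤ a≤b b≤d anchor = continue (redStretch a≤b b≤d anchor)
          where
            continue : RedStretch b → Result
            continue (i , j , b<i , i≤j , j<d , p∈ , redJ , ¬redJ) =
              [ (λ t∈ → i , suc j , m≤n⇒m≤1+n i≤j , j<d , p∈ , t∈)
              , (λ anchor′ → fromAnchor fuel (shiftFuel fuel d≤ (s≤s b≤j))
                                          (≤-trans a≤b (m≤n⇒m≤1+n b≤j)) j<d anchor′)
              ]′ (blueExit (≤-trans a≤b b≤j) j<d redJ ¬redJ)
              where
                b≤j : b ≤ j
                b≤j = ≤-trans (<⇒≤ b<i) i≤j

        fromRedStart : ∀ {b} → a ≤ b → b ≤ d → next x ≡ v b → R⁺ D x (v b) → Result
        fromRedStart {b} a≤b b≤d nx≡vb (xb , cb) =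
          continue (redRunEnds a≤b (outNeighbourBeforeEnd b≤d xb) (edgeDom xb cb))
          where
            continue : RedRunEnd b → Result
            continue (j , b≤j , j<d , redRun , ¬redJ) =
              fromAnchor d (m≤m+n d (suc j)) (≤-trans a≤b (m≤n⇒m≤1+n b≤j)) j<d
                (blueEntry a≤b (s≤s b≤j) j<d nx≡vb (λ l b≤l l≤j → redRun l b≤l (≤-pred l≤j)) ¬redJ)

      -- If x = v l, then l < d and x occurs nowhere else on the path, so v (suc l), …, v d is
      -- a segment starting at the successor of x; its edge from x is red or blue.
      afterX : ∀ {l} → l ≤ d → v l ≡ x → Result
      afterX {l} l≤d vl≡x = fromSuccessor (edgeAt (v (suc l)) (x∉ (suc l) ≤-refl l<d))
        where
          x∉ : ∀ l′ → suc l ≤ l′ → l′ ≤ d → v l′ ≢ x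
          x∉ l′ l<l′ l′≤d e = orbitDistinct m l<l′ (≤-<-trans l′≤d d<N) (trans vl≡x (sym e))
          l<d : l < d
          l<d = ≤∧≢⇒< l≤d λ { refl → arc-irrefl (proj₁ (proj₁ end∈)) vl≡x }
          nx≡ : next x ≡ v (suc l)
          nx≡ = cong next (sym vl≡x)
          xArc : arc x (v (suc l)) ≡ true
          xArc = subst (λ w → arc x w ≡ true) nx≡ (nextArc x)
          open Segment (suc l) x∉
          fromSuccessor : EdgeAt (v (suc l)) → Result
          fromSuccessor (outRed e)  = fromRedStart ≤-refl l<d nx≡ e
          fromSuccessor (outBlue e) = fromAnchor d (m≤m+n d (suc l)) ≤-refl l<d (e , inj₂ nx≡)
          fromSuccessor (inRed e)   = ⊥-elim (arc-asym xArc (proj₁ e))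
          fromSuccessor (inBlue e)  = ⊥-elim (arc-asym xArc (proj₁ e))

      -- Either x lies on the path, or the whole path is a segment starting at the anchor m.
      result : B⁺[_] D blue x m → Result
      result (xm , mDomX) = byOccurrence (between? 0 d x)
        where
          byOccurrence : Dec (Between 0 d x) → Result
          byOccurrence (yes (l , _ , l≤d , vl≡x)) = afterX l≤d vl≡x
          byOccurrence (no x∉path) =
            Segment.fromAnchor 0 (λ l _ l≤d e → x∉path (l , z≤n , l≤d , e))
              d (m≤m+n d 0) z≤n z≤n (xm , inj₁ mDomX)

corollary3p6 : ∀ {N : ℕ} (D : Tournament3 N) → MinimalCounterexample D →
    (C : HamiltonCycle D) → IsDominationCycle D C →
    (x : Fin N) → NoGreenAt D x →
    (∀ w → HamiltonCycle.next C w ≡ x → R⁻ D x w) →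
    (m k : Fin N) → B⁺[_] D blue x m → R⁻[_] D red x k →
    HamiltonCycle.next C k ≢ m →
    (d : ℕ) → d < N → iterate D (HamiltonCycle.next C) d m ≡ k →
    Σ ℕ λ i → Σ ℕ λ j → i ≤ j × j ≤ d ×
      R⁺[_] D red x (iterate D (HamiltonCycle.next C) i m) ×
      B⁻[_] D blue x (iterate D (HamiltonCycle.next C) j m)
corollary3p6 D MC C DC x NG _ m _ m∈ k∈ unclosed d d<N refl =
  OnPath.result m d d<N k∈ unclosed m∈
  where open MinimalCounterexampleFacts D MC C DC
        open GreenFree x NG
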